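{- Let $n \geq 4$ be an integer with $n \equiv 2 \pmod 4$. Then the honeycomb toroidal graph $\mathrm{HTG}(1,n,n/2)$ is not 2-spanning cyclable.
   Context: For integers $m\ge 1$, $\ell\ge 0$ and $n\ge 4$ with $n$ even and $m-\ell$ even, the honeycomb toroidal graph $\mathrm{HTG}(m,n,\ell)$ is the simple graph with vertex set $\{u_{i,j}: 0\le i\le m-1,\ 0\le j\le n-1\}$ (first subscript computed modulo $m$, second modulo $n$) whose edge set is the set of the following unordered pairs: $\{u_{i,j},u_{i,j+1}\}$ for all $i,j$ (vertical edges); $\{u_{i,j},u_{i+1,j}\}$ for all $0\le i\le m-2$ with $i+j$ odd (flat edges); and $\{u_{m-1,j},u_{0,j+\ell}\}$ for all $j$ having the same parity as $m$ (and $\ell$) (jump edges). A 2-factor of a graph is a spanning subgraph in which every vertex has valency 2. A graph $X$ is 2-spanning cyclable if for every pair of distinct vertices $u,v$ of $X$ there is a 2-factor of $X$ consisting of exactly two cycles such that $u$ and $v$ lie in different cycles. -}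

module Defs where

open import Data.Nat using (ℕ; zero; suc; _+_; _*_; _∸_; _<_; _%_)
open import Data.Fin using (Fin; toℕ)
open import Data.Product using (_×_; _,_; ∃-syntax; Σ-syntax)
open import Data.Sum using (_⊎_)
open import Data.Bool using (Bool)
open import Relation.Binary.PropositionalEquality using (_≡_; _≢_)
open import Relation.Binary.Construct.Closure.ReflexiveTransitive using (Star)

ModEq : ℕ → ℕ → ℕ → Set
ModEq n a b = (∃[ k ] (a + k * n ≡ b)) ⊎ (∃[ k ] (b + k * n ≡ a))

Vertex : ℕ → ℕ → Set
Vertex m n = Fin m × Fin n

data Edge (m n ℓ : ℕ) : Vertex m n → Vertex m n → Set where
  vert : ∀ i i' j j' → toℕ i ≡ toℕ i' → ModEq n (toℕ j + 1) (toℕ j') →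
         Edge m n ℓ (i , j) (i' , j')
  flat : ∀ i i' j j' → toℕ i + 1 < m → (toℕ i + toℕ j) % 2 ≡ 1 →
         toℕ i' ≡ toℕ i + 1 → toℕ j ≡ toℕ j' →
         Edge m n ℓ (i , j) (i' , j')
  jump : ∀ i i' j j' → toℕ i ≡ m ∸ 1 → toℕ i' ≡ 0 → toℕ j % 2 ≡ m % 2 →
         ModEq n (toℕ j + ℓ) (toℕ j') →
         Edge m n ℓ (i , j) (i' , j')

HTG-Adj : (m n ℓ : ℕ) → Vertex m n → Vertex m n → Set
HTG-Adj m n ℓ u v = Edge m n ℓ u v ⊎ Edge m n ℓ v u

Is2Factor : {V : Set} → (V → V → Set) → (V → V → Set) → Set
Is2Factor {V} Adj F =
  (∀ x y → F x y → F y x) ×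
  (∀ x y → F x y → Adj x y) ×
  (∀ x → Σ[ w₁ ∈ V ] Σ[ w₂ ∈ V ]
           (w₁ ≢ w₂ × F x w₁ × F x w₂ × (∀ w → F x w → (w ≡ w₁ ⊎ w ≡ w₂))))

-- The 2-factor F consists of exactly two cycles (components), described by
-- a 2-colouring c whose colour classes are exactly the connected components
-- of F; u and v lie in different cycles.
TwoCyclesSeparating : {V : Set} → (V → V → Set) → V → V → Set
TwoCyclesSeparating {V} F u v =
  Σ[ c ∈ (V → Bool) ]
    ((∀ x y → F x y → c x ≡ c y) ×
     (∀ x y → c x ≡ c y → Star F x y) ×
     c u ≢ c v)

TwoSpanningCyclable : (V : Set) → (V → V → Set) → Set₁
TwoSpanningCyclable V Adj =
  ∀ (u v : V) → u ≢ v →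
    Σ[ F ∈ (V → V → Set) ] (Is2Factor Adj F × TwoCyclesSeparating F u v)

{-# OPTIONS --safe #-}
-- For m = 1 and ℓ = k = n/2 the graph is the n-cycle u₀ u₁ … u_{n-1} plus antipodal
-- chords u_j u_{j+k}. Suppose a 2-factor with two cycles separates u₀ from u_k, and
-- colour its cycles. Inductively c(u_j) = c(u₀) and c(u_{j+k}) = c(u_k): the chord
-- u_j u_{j+k} joins different colours, so it is not in the 2-factor, and u_j, having
-- valency 2 and only the cycle neighbours u_{j±1} left, must use the edge u_j u_{j+1};
-- likewise u_{j+k}, whose chord is the same one. At j = k this gives c(u_k) = c(u₀).
module Submission where

open import Defs
open import Data.Nat using (ℕ; _≤_; _%_; _/_)
open import Relation.Binary.PropositionalEquality using (_≡_)
open import Relation.Nullary using (¬_)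

open import Data.Nat using (zero; suc; pred; _+_; _*_; _<_; z≤n; s≤s; NonZero)
open import Data.Nat.Properties
open import Data.Nat.DivMod
open import Data.Nat.Divisibility using (divides; m%n≡0⇒n∣m)
open import Data.Fin using (Fin; toℕ; fromℕ<) renaming (zero to fzero)
open import Data.Fin.Properties using (toℕ-injective; toℕ-fromℕ<; toℕ<n)
open import Data.Product using (_×_; _,_; proj₁; proj₂; Σ-syntax)
open import Data.Sum using (_⊎_; inj₁; inj₂)
open import Data.Bool using (Bool)
open import Data.Empty using (⊥-elim)
open import Function using (_∘_)
open import Relation.Binary.PropositionalEquality
  using (_≢_; refl; sym; trans; cong; subst; module ≡-Reasoning)

module _ (n : ℕ) {{_ : NonZero n}} where

  [m%n+o]%n≡[m+o]%n : ∀ m o → (m % n + o) % n ≡ (m + o) % n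
  [m%n+o]%n≡[m+o]%n m o = begin
    (m % n + o) % n          ≡⟨ %-distribˡ-+ (m % n) o n ⟩
    (m % n % n + o % n) % n  ≡⟨ cong (λ r → (r + o % n) % n) (m%n%n≡m%n m n) ⟩
    (m % n + o % n) % n      ≡⟨ %-distribˡ-+ m o n ⟨
    (m + o) % n              ∎
    where open ≡-Reasoning

  ModEq⇒≡% : ∀ {x y} → y < n → ModEq n x y → y ≡ x % n
  ModEq⇒≡% {x} {y} y<n (inj₁ (q , x+qn≡y)) = begin
    y               ≡⟨ m<n⇒m%n≡m y<n ⟨
    y % n           ≡⟨ cong (_% n) x+qn≡y ⟨
    (x + q * n) % n ≡⟨ [m+kn]%n≡m%n x q n ⟩
    x % n           ∎
    where open ≡-Reasoning
  ModEq⇒≡% {x} {y} y<n (inj₂ (q , y+qn≡x)) = begin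
    y               ≡⟨ m<n⇒m%n≡m y<n ⟨
    y % n           ≡⟨ [m+kn]%n≡m%n y q n ⟨
    (y + q * n) % n ≡⟨ cong (_% n) y+qn≡x ⟩
    x % n           ∎
    where open ≡-Reasoning

  -- Subtracting c modulo n is adding its complement d = n - c.
  a≡[t+c]%n⇒t≡[a+d]%n : ∀ {t a} c d → t < n → c + d ≡ n → a ≡ (t + c) % n → t ≡ (a + d) % n
  a≡[t+c]%n⇒t≡[a+d]%n {t} {a} c d t<n c+d≡n a≡[t+c]%n = begin
    t                     ≡⟨ m<n⇒m%n≡m t<n ⟨
    t % n                 ≡⟨ [m+n]%n≡m%n t n ⟨
    (t + n) % n           ≡⟨ cong (λ r → (t + r) % n) c+d≡n ⟨
    (t + (c + d)) % n     ≡⟨ cong (_% n) (+-assoc t c d) ⟨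
    (t + c + d) % n       ≡⟨ [m%n+o]%n≡[m+o]%n (t + c) d ⟨
    ((t + c) % n + d) % n ≡⟨ cong (λ r → (r + d) % n) a≡[t+c]%n ⟨
    (a + d) % n           ∎
    where open ≡-Reasoning

  at : ℕ → Vertex 1 n
  at i = fzero , fromℕ< (m%n<n i n)

  toℕ-at : ∀ i → toℕ (proj₂ (at i)) ≡ i % n
  toℕ-at i = toℕ-fromℕ< (m%n<n i n)

  toℕ-at-< : ∀ {i} → i < n → toℕ (proj₂ (at i)) ≡ i
  toℕ-at-< {i} i<n = trans (toℕ-at i) (m<n⇒m%n≡m i<n)

  ≡at : ∀ {b : Fin n} {i} → toℕ b ≡ i % n → (fzero , b) ≡ at i
  ≡at {i = i} b≡i%n = cong (fzero ,_) (toℕ-injective (trans b≡i%n (sym (toℕ-at i))))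

  at-cong : ∀ {i j} → i % n ≡ j % n → at i ≡ at j
  at-cong {i} i%n≡j%n = ≡at (trans (toℕ-at i) i%n≡j%n)

  at-offset : ∀ i c {b : Fin n} → ModEq n (toℕ (proj₂ (at i)) + c) (toℕ b) → (fzero , b) ≡ at (i + c)
  at-offset i c {b} i+c≡b = ≡at (begin
    toℕ b                              ≡⟨ ModEq⇒≡% (toℕ<n b) i+c≡b ⟩
    (toℕ (proj₂ (at i)) + c) % n       ≡⟨ cong (λ r → (r + c) % n) (toℕ-at i) ⟩
    (i % n + c) % n                    ≡⟨ [m%n+o]%n≡[m+o]%n i c ⟩
    (i + c) % n                        ∎)
    where open ≡-Reasoning

  at-offset⁻¹ : ∀ i c d {b : Fin n} → c + d ≡ n →
                ModEq n (toℕ b + c) (toℕ (proj₂ (at i))) → (fzero , b) ≡ at (i + d)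
  at-offset⁻¹ i c d {b} c+d≡n b+c≡i = ≡at (begin
    toℕ b                              ≡⟨ a≡[t+c]%n⇒t≡[a+d]%n c d (toℕ<n b) c+d≡n
                                            (ModEq⇒≡% (toℕ<n (proj₂ (at i))) b+c≡i) ⟩
    (toℕ (proj₂ (at i)) + d) % n       ≡⟨ cong (λ r → (r + d) % n) (toℕ-at i) ⟩
    (i % n + d) % n                    ≡⟨ [m%n+o]%n≡[m+o]%n i d ⟩
    (i + d) % n                        ∎)
    where open ≡-Reasoning

  module Antipodal (k : ℕ) (k+k≡n : k + k ≡ n) where

    -- u_{i-1} is written u_{i + pred n} to avoid truncated subtraction; flat edges would
    -- need 0 + 1 < 1, so Agda discards them as absurd.
    neighbours : ∀ i {w} → HTG-Adj 1 n k (at i) w →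
                 w ≡ at (i + 1) ⊎ w ≡ at (i + pred n) ⊎ w ≡ at (i + k)
    neighbours i {fzero , b} (inj₁ (Edge.vert _ _ _ _ _ i+1≡b)) = inj₁ (at-offset i 1 i+1≡b)
    neighbours i {fzero , b} (inj₁ (Edge.jump _ _ _ _ _ _ _ i+k≡b)) = inj₂ (inj₂ (at-offset i k i+k≡b))
    neighbours i {fzero , b} (inj₂ (Edge.vert _ _ _ _ _ b+1≡i)) =
      inj₂ (inj₁ (at-offset⁻¹ i 1 (pred n) (suc-pred n) b+1≡i))
    neighbours i {fzero , b} (inj₂ (Edge.jump _ _ _ _ _ _ _ b+k≡i)) =
      inj₂ (inj₂ (at-offset⁻¹ i k k k+k≡n b+k≡i))

    at-antipode-involutive : ∀ i → at (i + k + k) ≡ at i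
    at-antipode-involutive i = at-cong (begin
      (i + k + k) % n    ≡⟨ cong (_% n) (+-assoc i k k) ⟩
      (i + (k + k)) % n  ≡⟨ cong (λ r → (i + r) % n) k+k≡n ⟩
      (i + n) % n        ≡⟨ [m+n]%n≡m%n i n ⟩
      i % n              ∎)
      where open ≡-Reasoning

    module _ {F : Vertex 1 n → Vertex 1 n → Set} (F⊆Adj : ∀ x y → F x y → HTG-Adj 1 n k x y)
             (two-regular : ∀ x → Σ[ w₁ ∈ Vertex 1 n ] Σ[ w₂ ∈ Vertex 1 n ]
                (w₁ ≢ w₂ × F x w₁ × F x w₂ × (∀ w → F x w → (w ≡ w₁ ⊎ w ≡ w₂))))
      where

      suc-edge-unless-antipodal : ∀ i → ¬ F (at i) (at (i + k)) → F (at i) (at (suc i))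
      suc-edge-unless-antipodal i no-chord
        with w₁ , w₂ , w₁≢w₂ , Fw₁ , Fw₂ , _ ← two-regular (at i)
        with neighbours i (F⊆Adj _ _ Fw₁) | neighbours i (F⊆Adj _ _ Fw₂)
      ... | inj₁ w₁≡i+1 | _ = subst (F (at i)) (trans w₁≡i+1 (cong at (+-comm i 1))) Fw₁
      ... | inj₂ _ | inj₁ w₂≡i+1 = subst (F (at i)) (trans w₂≡i+1 (cong at (+-comm i 1))) Fw₂
      ... | inj₂ (inj₂ w₁≡i+k) | inj₂ _ = ⊥-elim (no-chord (subst (F (at i)) w₁≡i+k Fw₁))
      ... | inj₂ (inj₁ _) | inj₂ (inj₂ w₂≡i+k) = ⊥-elim (no-chord (subst (F (at i)) w₂≡i+k Fw₂))
      ... | inj₂ (inj₁ w₁≡i-1) | inj₂ (inj₁ w₂≡i-1) = ⊥-elim (w₁≢w₂ (trans w₁≡i-1 (sym w₂≡i-1)))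

      module _ (c : Vertex 1 n → Bool) (c-respects-F : ∀ x y → F x y → c x ≡ c y)
               (c₀≢cₖ : c (at 0) ≢ c (at k)) where

        colours-of-opposite-halves : ∀ i → c (at i) ≡ c (at 0) × c (at (i + k)) ≡ c (at k)
        colours-of-opposite-halves zero = refl , refl
        colours-of-opposite-halves (suc i) with cᵢ≡c₀ , cᵢ₊ₖ≡cₖ ← colours-of-opposite-halves i =
          trans (sym (c-respects-F _ _ (suc-edge-unless-antipodal i chord-absent))) cᵢ≡c₀ ,
          trans (sym (c-respects-F _ _ (suc-edge-unless-antipodal (i + k) opposite-chord-absent))) cᵢ₊ₖ≡cₖ
          where
          chord-absent : ¬ F (at i) (at (i + k))
          chord-absent Fchord = c₀≢cₖ (trans (sym cᵢ≡c₀) (trans (c-respects-F _ _ Fchord) cᵢ₊ₖ≡cₖ))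

          opposite-chord-absent : ¬ F (at (i + k)) (at (i + k + k))
          opposite-chord-absent Fchord = c₀≢cₖ (begin
            c (at 0)           ≡⟨ cᵢ≡c₀ ⟨
            c (at i)           ≡⟨ cong c (at-antipode-involutive i) ⟨
            c (at (i + k + k)) ≡⟨ c-respects-F _ _ Fchord ⟨
            c (at (i + k))     ≡⟨ cᵢ₊ₖ≡cₖ ⟩
            c (at k)           ∎)
            where open ≡-Reasoning

  at0≢at : ∀ {k} → 0 < k → k < n → at 0 ≢ at k
  at0≢at {k} 0<k k<n at0≡atk = <⇒≢ 0<k (begin
    0                   ≡⟨ toℕ-at-< (<-trans 0<k k<n) ⟨
    toℕ (proj₂ (at 0))  ≡⟨ cong (toℕ ∘ proj₂) at0≡atk ⟩
    toℕ (proj₂ (at k))  ≡⟨ toℕ-at-< k<n ⟩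
    k                   ∎)
    where open ≡-Reasoning

  htg-1-antipodal-not-2-spanning-cyclable : ∀ k → k + k ≡ n → 0 < k →
    ¬ TwoSpanningCyclable (Vertex 1 n) (HTG-Adj 1 n k)
  htg-1-antipodal-not-2-spanning-cyclable k k+k≡n 0<k cyclable
    with F , (_ , F⊆Adj , two-regular) , (c , c-respects-F , _ , c₀≢cₖ)
           ← cyclable (at 0) (at k) (at0≢at 0<k (subst (k <_) k+k≡n (m<m+n k 0<k)))
    = c₀≢cₖ (sym (proj₁ (colours-of-opposite-halves F⊆Adj two-regular c c-respects-F c₀≢cₖ k)))
    where open Antipodal k k+k≡n

proposition2p1 : (n : ℕ) → 4 ≤ n → n % 4 ≡ 2 →
    ¬ TwoSpanningCyclable (Vertex 1 n) (HTG-Adj 1 n (n / 2))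
proposition2p1 zero ()
proposition2p1 n@(suc _) 4≤n n%4≡2 =
  htg-1-antipodal-not-2-spanning-cyclable n (n / 2) half+half≡n (m≥n⇒m/n>0 (≤-trans (s≤s (s≤s z≤n)) 4≤n))
  where
  n%2≡0 : n % 2 ≡ 0
  n%2≡0 = trans (sym (m∣n⇒o%n%m≡o%m 2 4 n (divides 2 refl))) (cong (_% 2) n%4≡2)

  half+half≡n : n / 2 + n / 2 ≡ n
  half+half≡n = trans (cong (n / 2 +_) (sym (+-identityʳ (n / 2))))
                  (trans (*-comm 2 (n / 2)) (m/n*n≡m (m%n≡0⇒n∣m n 2 n%2≡0)))
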